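{- For any connected graph $G$, the sibling of $G$ is prime.
   Context: Graphs are finite and simple. The sibling of a graph $G$ is the graph obtained from $G$ by adding, for each $x\in V(G)$, a new vertex $x'$ adjacent only to $x$. A module of a graph $H$ is a non-empty $S\subseteq V(H)$ such that every vertex of $V(H)\setminus S$ is adjacent to all or none of the vertices of $S$; a module is non-trivial if it is a proper subset of $V(H)$ with at least two vertices; $H$ is prime if it has no non-trivial module. -}

module Defs where

open import Data.Nat using (ℕ)
open import Data.Bool using (Bool; true; false)
open import Data.Fin using (Fin; _≟_)
open import Data.Fin.Properties using ()
open import Data.Sum using (_⊎_; inj₁; inj₂)
open import Data.Product using (Σ; _×_; ∃; ∃-syntax; _,_)
open import Relation.Nullary using (¬_; yes; no)
open import Relation.Nullary.Decidable using (⌊_⌋)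
open import Relation.Binary.PropositionalEquality using (_≡_; _≢_; refl; sym)

record Graph (n : ℕ) : Set where
  field
    adj    : Fin n → Fin n → Bool
    adj-sym    : ∀ x y → adj x y ≡ adj y x
    adj-irrefl : ∀ x → adj x x ≡ false
open Graph public

data Walk {n : ℕ} (G : Graph n) : Fin n → Fin n → Set where
  here : ∀ {x} → Walk G x x
  step : ∀ {x y z} → adj G x y ≡ true → Walk G y z → Walk G x z

Connected : {n : ℕ} → Graph n → Set
Connected G = ∀ x y → Walk G x y

-- Sibling graph: vertex set Fin n ⊎ Fin n; inj₁ x is the original vertex x,
-- inj₂ x is the new vertex x', adjacent only to inj₁ x.
sibAdj : {n : ℕ} → Graph n → Fin n ⊎ Fin n → Fin n ⊎ Fin n → Bool
sibAdj G (inj₁ x) (inj₁ y) = adj G x y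
sibAdj G (inj₁ x) (inj₂ y) = ⌊ x ≟ y ⌋
sibAdj G (inj₂ x) (inj₁ y) = ⌊ x ≟ y ⌋
sibAdj G (inj₂ x) (inj₂ y) = false

record GraphOn (V : Set) : Set where
  field
    gadj    : V → V → Bool
    gadj-sym    : ∀ x y → gadj x y ≡ gadj y x
    gadj-irrefl : ∀ x → gadj x x ≡ false
open GraphOn public

private
  ⌊≟⌋-sym : {n : ℕ} (x y : Fin n) → ⌊ x ≟ y ⌋ ≡ ⌊ y ≟ x ⌋
  ⌊≟⌋-sym x y with x ≟ y | y ≟ x
  ... | yes _ | yes _ = refl
  ... | no _  | no _  = refl
  ... | yes p | no q  with q (sym p)
  ... | ()
  ⌊≟⌋-sym x y | no q | yes p with q (sym p)
  ... | ()

sibling : {n : ℕ} → Graph n → GraphOn (Fin n ⊎ Fin n)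
sibling G = record { gadj = sibAdj G ; gadj-sym = s ; gadj-irrefl = i }
  where
  s : ∀ u v → sibAdj G u v ≡ sibAdj G v u
  s (inj₁ x) (inj₁ y) = adj-sym G x y
  s (inj₁ x) (inj₂ y) = ⌊≟⌋-sym x y
  s (inj₂ x) (inj₁ y) = ⌊≟⌋-sym x y
  s (inj₂ x) (inj₂ y) = refl
  i : ∀ u → sibAdj G u u ≡ false
  i (inj₁ x) = adj-irrefl G x
  i (inj₂ x) = refl

IsModule : {V : Set} → GraphOn V → (V → Bool) → Set
IsModule H S =
  (∃[ x ] S x ≡ true) ×
  (∀ z → S z ≡ false → ∀ x y → S x ≡ true → S y ≡ true → gadj H z x ≡ gadj H z y)

NonTrivial : {V : Set} → (V → Bool) → Set
NonTrivial S =
  (∃[ z ] S z ≡ false) ×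
  (∃[ x ] ∃[ y ] (x ≢ y × S x ≡ true × S y ≡ true))

Prime : {V : Set} → GraphOn V → Set
Prime H = ∀ S → IsModule H S → ¬ NonTrivial S

-- Let S be a module of the sibling with at least two vertices. If x ∈ S then x' ∈ S, since
-- otherwise x' would be adjacent to all of S while its only neighbour is x. If x' ∈ S then
-- x ∈ S, since otherwise x would be adjacent to every other member: not to a pendant other
-- than x', and not to an original y ∈ S either, because then y' ∈ S as well. An original
-- vertex y ∉ S adjacent to an original x ∈ S would likewise be adjacent to x' ∈ S, so the
-- originals in S are closed under walks; by connectedness S contains every vertex.
module Submission where

open import Defs
open import Data.Nat using (ℕ)
open import Data.Bool using (Bool; true; false)
open import Data.Bool.Properties using (T-≡; ¬-not; not-¬)
open import Data.Fin using (Fin; _≟_)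
open import Data.Sum using (_⊎_; inj₁; inj₂; reduce)
open import Data.Sum.Properties using (≡-dec)
open import Data.Product using (_×_; ∃-syntax; _,_; proj₁; proj₂)
open import Data.Empty using (⊥)
open import Function.Base using (id)
open import Function.Bundles using (Equivalence)
open import Relation.Nullary using (yes; no)
open import Relation.Nullary.Decidable using (⌊_⌋; toWitness; fromWitness)
open import Relation.Binary.Definitions using (DecidableEquality)
open import Relation.Binary.PropositionalEquality using (_≡_; _≢_; refl; sym; trans; cong; subst)

Nonsingleton : {V : Set} → (V → Bool) → Set
Nonsingleton S = ∀ w → S w ≡ true → ∃[ u ] (u ≢ w × S u ≡ true)

nonsingleton : {V : Set} {S : V → Bool} {x y : V} → DecidableEquality V →
               x ≢ y → S x ≡ true → S y ≡ true → Nonsingleton S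
nonsingleton {x = x} {y} _≟ᵥ_ x≢y x∈S y∈S w _ with x ≟ᵥ w
... | yes refl = y , (λ y≡x → x≢y (sym y≡x)) , y∈S
... | no x≢w   = x , x≢w , x∈S

module _ {V : Set} (H : GraphOn V) {S : V → Bool} (M : IsModule H S) where

  outsider-adj-member⇒adj-all : ∀ {z x y} → S z ≡ false → S x ≡ true → S y ≡ true →
                                 gadj H z x ≡ true → gadj H z y ≡ true
  outsider-adj-member⇒adj-all {z} {x} {y} z∉S x∈S y∈S z~x =
    trans (sym (proj₂ M z z∉S x y x∈S y∈S)) z~x

⌊≟⌋-true⇒≡ : {n : ℕ} {a b : Fin n} → ⌊ a ≟ b ⌋ ≡ true → a ≡ b
⌊≟⌋-true⇒≡ p = toWitness (Equivalence.from T-≡ p)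

⌊≟⌋-refl : {n : ℕ} (a : Fin n) → ⌊ a ≟ a ⌋ ≡ true
⌊≟⌋-refl a = Equivalence.to T-≡ (fromWitness refl)

module _ {n : ℕ} (G : Graph n) where

  pendant-anchor-adj : ∀ a → gadj (sibling G) (inj₂ a) (inj₁ a) ≡ true
  pendant-anchor-adj = ⌊≟⌋-refl

  pendant-adj⇒anchor : ∀ a v → gadj (sibling G) (inj₂ a) v ≡ true → v ≡ inj₁ a
  pendant-adj⇒anchor a (inj₁ b) a~b = cong inj₁ (sym (⌊≟⌋-true⇒≡ a~b))
  pendant-adj⇒anchor a (inj₂ b) ()

  module SiblingModule {S : Fin n ⊎ Fin n → Bool} (M : IsModule (sibling G) S)
                       (S-nonsingleton : Nonsingleton S) where

    adj-all : ∀ {z x y} → S z ≡ false → S x ≡ true → S y ≡ true →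
              gadj (sibling G) z x ≡ true → gadj (sibling G) z y ≡ true
    adj-all = outsider-adj-member⇒adj-all (sibling G) M

    outsider-adj-pendant-of-member : ∀ {c b} → S (inj₁ c) ≡ false → S (inj₁ b) ≡ true →
                                     gadj (sibling G) (inj₁ c) (inj₂ b) ≡ true → ⊥
    outsider-adj-pendant-of-member c∉S b∈S c~b′ =
      not-¬ (subst (λ d → S (inj₁ d) ≡ true) (sym (⌊≟⌋-true⇒≡ c~b′)) b∈S) c∉S

    anchor∈⇒pendant∈ : ∀ a → S (inj₁ a) ≡ true → S (inj₂ a) ≡ true
    anchor∈⇒pendant∈ a a∈S = ¬-not λ a′∉S →
      let u , u≢a , u∈S = S-nonsingleton (inj₁ a) a∈S
      in  u≢a (pendant-adj⇒anchor a u (adj-all a′∉S a∈S u∈S (pendant-anchor-adj a)))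

    pendant∈⇒anchor∈ : ∀ a → S (inj₂ a) ≡ true → S (inj₁ a) ≡ true
    pendant∈⇒anchor∈ a a′∈S = ¬-not λ a∉S →
      let u , u≢a′ , u∈S = S-nonsingleton (inj₂ a) a′∈S
          a~u = adj-all a∉S a′∈S u∈S (pendant-anchor-adj a)
      in  anchor-sees-only-its-pendant a∉S u u≢a′ u∈S a~u
      where
      anchor-sees-only-its-pendant : S (inj₁ a) ≡ false → ∀ u → u ≢ inj₂ a → S u ≡ true →
                                     gadj (sibling G) (inj₁ a) u ≡ true → ⊥
      anchor-sees-only-its-pendant a∉S (inj₂ c) u≢a′ _ a~c′ =
        u≢a′ (cong inj₂ (sym (⌊≟⌋-true⇒≡ a~c′)))
      anchor-sees-only-its-pendant a∉S (inj₁ b) _ b∈S _ =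
        outsider-adj-pendant-of-member a∉S b∈S
          (adj-all a∉S a′∈S (anchor∈⇒pendant∈ b b∈S) (pendant-anchor-adj a))

    neighbour∈ : ∀ {a y} → adj G a y ≡ true → S (inj₁ a) ≡ true → S (inj₁ y) ≡ true
    neighbour∈ {a} {y} a~y a∈S = ¬-not λ y∉S →
      outsider-adj-pendant-of-member y∉S a∈S
        (adj-all y∉S a∈S (anchor∈⇒pendant∈ a a∈S) (trans (adj-sym G y a) a~y))

    walk-end∈ : ∀ {a c} → Walk G a c → S (inj₁ a) ≡ true → S (inj₁ c) ≡ true
    walk-end∈ here         a∈S = a∈S
    walk-end∈ (step a~y w) a∈S = walk-end∈ w (neighbour∈ a~y a∈S)

    member⇒anchor∈ : ∀ v → S v ≡ true → S (inj₁ (reduce v)) ≡ true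
    member⇒anchor∈ (inj₁ a) = id
    member⇒anchor∈ (inj₂ a) = pendant∈⇒anchor∈ a

    anchor∈⇒member : ∀ v → S (inj₁ (reduce v)) ≡ true → S v ≡ true
    anchor∈⇒member (inj₁ a) = id
    anchor∈⇒member (inj₂ a) = anchor∈⇒pendant∈ a

    connected⇒full : Connected G → ∀ v → S v ≡ true
    connected⇒full conn v =
      let x , x∈S = proj₁ M
      in  anchor∈⇒member v (walk-end∈ (conn (reduce x) (reduce v)) (member⇒anchor∈ x x∈S))

lemma1 : (n : ℕ) (G : Graph n) → Connected G → Prime (sibling G)
lemma1 n G conn S M ((z , z∉S) , (x , y , x≢y , x∈S , y∈S)) = not-¬ (connected⇒full conn z) z∉S
  where
  open SiblingModule G M (nonsingleton (≡-dec _≟_ _≟_) x≢y x∈S y∈S)
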